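{- Let $n$ be a positive integer, let $C_n^+$ be a strongly oriented cycle on a vertex set $V$ of size $n$, let $C_n^-$ be its reverse on the same vertex set, and let $\Gamma=\{C_n^+,C_n^-\}$. Let $G=G_1+G_2+\cdots+G_l$ be a simple graph where each $G_i=(T_1^i(w_1^i),T_2^i(w_2^i),\dots,T_{m_i}^i(w_{m_i}^i))$ with each $T_j^i$ a tree. Let $D=D_1+\cdots+D_l$ be an oriented graph obtained from $G$ by choosing a strong orientation of each of its cycles (and any orientation of the remaining edges), with $\mathrm{und}(D_i)=G_i$. Let $h:E(D)\to\{C_n^+,C_n^-\}$ be any function such that, for each $i$, $h$ assigns $C_n^-$ to exactly $r_i$ arcs of the cycle of $D_i$. Then $$\mathrm{und}(D\otimes_h\Gamma)\cong \frac{n}{k_1}\big(T_1^1(w_1^1),\dots,T_{m_1}^1(w_{m_1}^1)\big)^{k_1}+\cdots+\frac{n}{k_l}\big(T_1^l(w_1^l),\dots,T_{m_l}^l(w_{m_l}^l)\big)^{k_l},$$ where, for each $i$, $k_i$ is the order of the subgroup of $\mathbb{Z}_n$ generated by $m_i-2r_i$.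
   Context: Notation: for trees $T_1,\dots,T_m$ (each of order $\ge1$) and vertices $w_j\in V(T_j)$, $(T_1(w_1),\dots,T_m(w_m))$ denotes the unicyclic graph obtained from a cycle with vertices $a_1,\dots,a_m$ (edges $a_ja_{j+1}$ and $a_ma_1$) and disjoint copies of $T_1,\dots,T_m$ by identifying $w_j$ with $a_j$. For $k\ge1$, $(T_1(w_1),\dots,T_m(w_m))^k$ denotes $(T_1(w_1),\dots,T_m(w_m),T_1(w_1),\dots,T_m(w_m),\dots,T_1(w_1),\dots,T_m(w_m))$ with the block of $m$ entries repeated $k$ times (a unicyclic graph with a cycle of length $mk$). $+$ is disjoint union and $tH$ is $t$ disjoint copies of $H$. $\mathrm{und}$ denotes underlying graph. Product: for a digraph $D$, a family $\Gamma$ of digraphs with common vertex set $V$ and $h:E(D)\to\Gamma$, $D\otimes_h\Gamma$ has vertex set $V(D)\times V$ and $((a,x),(b,y))$ is an arc iff $(a,b)\in E(D)$ and $(x,y)\in E(h(a,b))$. -}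

module Defs where

open import Data.Nat using (ℕ; zero; suc; _+_; _*_; _≤_; _<_; _%_)
open import Data.Nat.DivMod using (m%n<n)
open import Data.Fin using (Fin; toℕ; fromℕ<; remainder)
open import Data.Bool using (Bool; true; false; if_then_else_)
open import Data.Product using (Σ; _×_; _,_)
open import Data.Sum using (_⊎_)
open import Data.Empty using (⊥)
open import Data.Integer as ℤ using (ℤ; +_)
open import Data.Integer.Divisibility as ℤD using ()
open import Relation.Binary.PropositionalEquality using (_≡_)
open import Relation.Binary.Construct.Closure.ReflexiveTransitive using (Star)
open import Function.Bundles using (_↔_; _⇔_; Inverse)

-- Graphs: a vertex type together with an adjacency relation.
-- (Simple graphs are represented by symmetric irreflexive relations;
-- underlying graphs of digraphs are obtained by symmetrising arcs.)

record Graph : Set₁ where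
  field
    V : Set
    E : V → V → Set
open Graph public

record _≅_ (G H : Graph) : Set where
  field
    bij : V G ↔ V H
    adj : ∀ x y → E G x y ⇔ E H (Inverse.to bij x) (Inverse.to bij y)

data SumE (l : ℕ) (G : Fin l → Graph) : Σ (Fin l) (λ i → V (G i)) → Σ (Fin l) (λ i → V (G i)) → Set where
  inc : ∀ i x y → E (G i) x y → SumE l G (i , x) (i , y)

Sum : (l : ℕ) → (Fin l → Graph) → Graph
Sum l G = record { V = Σ (Fin l) (λ i → V (G i)) ; E = SumE l G }

copies : ℕ → Graph → Graph
copies t H = Sum t (λ _ → H)

next : ∀ {L} → Fin L → Fin L
next {suc L} i = fromℕ< (m%n<n (suc (toℕ i)) (suc L))

Adj : ℕ → Set₁
Adj N = Fin N → Fin N → Set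

record HasCycle {N : ℕ} (adj : Adj N) : Set where
  field
    L     : ℕ
    3≤L   : 3 ≤ L
    c     : Fin L → Fin N
    c-inj : ∀ p q → c p ≡ c q → p ≡ q
    c-adj : ∀ p → adj (c p) (c (next p))

record IsTree {N : ℕ} (adj : Adj N) : Set where
  field
    sym       : ∀ x y → adj x y → adj y x
    irrefl    : ∀ x → adj x x → ⊥
    connected : ∀ x y → Star adj x y
    acyclic   : HasCycle adj → ⊥

-- The unicyclic graph (T_0(w_0), ..., T_{L-1}(w_{L-1})) with cycle
-- a_0 a_1 ... a_{L-1} a_0, a_p identified with w_p ∈ T_p.
-- Vertex (p , x) is vertex x of the copy of T_p.

CycAdj : ∀ {L} → Fin L → Fin L → Set
CycAdj p q = (q ≡ next p) ⊎ (p ≡ next q)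

data UniE (L : ℕ) (N : Fin L → ℕ) (T : (p : Fin L) → Adj (N p)) (w : (p : Fin L) → Fin (N p))
     : Σ (Fin L) (λ p → Fin (N p)) → Σ (Fin L) (λ p → Fin (N p)) → Set where
  tree : ∀ p x y → T p x y → UniE L N T w (p , x) (p , y)
  cyc  : ∀ p q → CycAdj p q → UniE L N T w (p , w p) (q , w q)

Unicyclic : (L : ℕ) (N : Fin L → ℕ) (T : (p : Fin L) → Adj (N p)) (w : (p : Fin L) → Fin (N p)) → Graph
Unicyclic L N T w = record { V = Σ (Fin L) (λ p → Fin (N p)) ; E = UniE L N T w }

-- (T_0(w_0), ..., T_{m-1}(w_{m-1}))^k : the block repeated k times,
-- cycle of length k*m, position p carries T_{p mod m}.
UnicyclicPow : (m : ℕ) (N : Fin m → ℕ) (T : (j : Fin m) → Adj (N j)) (w : (j : Fin m) → Fin (N j)) (k : ℕ) → Graph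
UnicyclicPow m N T w k =
  Unicyclic (k * m) (λ p → N (remainder {k} m p)) (λ p → T (remainder {k} m p)) (λ p → w (remainder {k} m p))

record IsOrientation (G : Graph) (A : V G → V G → Set) : Set where
  field
    edges   : ∀ x y → E G x y ⇔ (A x y ⊎ A y x)
    antisym : ∀ x y → A x y → A y x → ⊥

Cplus : ∀ {n} {V' : Set} → V' ↔ Fin n → V' → V' → Set
Cplus σ x y = Inverse.to σ y ≡ next (Inverse.to σ x)

Cminus : ∀ {n} {V' : Set} → V' ↔ Fin n → V' → V' → Set
Cminus σ x y = Cplus σ y x

-- label false = C_n^+, label true = C_n^-
Γarc : ∀ {n} {V' : Set} → V' ↔ Fin n → Bool → V' → V' → Set
Γarc σ false = Cplus σ
Γarc σ true  = Cminus σ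

-- D ⊗_h Γ for a digraph (VD , A), h : arcs → Γ (given on all pairs,
-- only its values on arcs matter)
ProdArc : ∀ {n} {VD V' : Set} (A : VD → VD → Set) (h : VD → VD → Bool) (σ : V' ↔ Fin n)
          → VD × V' → VD × V' → Set
ProdArc A h σ (a , x) (b , y) = A a b × Γarc σ (h a b) x y

und : (W : Set) → (W → W → Set) → Graph
und W R = record { V = W ; E = λ p q → R p q ⊎ R q p }

countTrue : (m : ℕ) → (Fin m → Bool) → ℕ
countTrue zero    f = 0
countTrue (suc m) f = (if f Fin.zero then 1 else 0) + countTrue m (λ j → f (Fin.suc j))
  where import Data.Fin as Fin

IsSubgroupOrder : ℕ → ℤ → ℕ → Set
IsSubgroupOrder n g k =
  (0 < k) × ((+ n) ℤD.∣ ((+ k) ℤ.* g)) × (∀ k' → 0 < k' → (+ n) ℤD.∣ ((+ k') ℤ.* g) → k ≤ k')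

-- Give every edge uv of G the voltage ±1 of its arc (+1 for C_n^+, -1 for C_n^-, negated when the arc
-- points from v to u).  Then (u , y) ~ (v , y′) in und(D ⊗_h Γ) iff uv is an edge and y′ = y + voltage in
-- ℤ_n.  Trees have no cycles, so on the tree T_j the voltages are differences of a potential vanishing at
-- the root w_j; adding the sum of the voltages of the cycle path a_1 … a_j gives a potential on all of G_i
-- such that every edge keeps the level y − potential fixed, except the closing cycle edge, which shifts it
-- by the net voltage g_i = ±(m_i − 2 r_i).  As ⟨g_i⟩ has order k_i and index q_i, every level is uniquely
-- c + u·g_i with c < q_i and u < k_i, and ((j , x) , y) corresponds to vertex x of the tree at position
-- u·m_i + j of the c-th copy of the k_i-fold cycle.

module Submission where

import Algebra.Properties.CommutativeSemigroup as CommutativeSemigroupProperties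
open import Data.Bool using (Bool; true; false; if_then_else_)
open import Data.Empty using (⊥-elim)
open import Data.Fin as Fin using (Fin; zero; suc; toℕ; fromℕ<; combine; remQuot; quotient; remainder)
import Data.Fin.Properties as Fin
open import Data.Integer as ℤ using (ℤ; ∣_∣; +_; _+_; _-_; -_; 0ℤ; 1ℤ; -1ℤ) renaming (_*_ to _·_)
import Data.Integer.Divisibility as ℤᵤ
open import Data.Integer.Divisibility.Signed
  using (_∣_; divides; ∣ᵤ⇒∣; ∣⇒∣ᵤ; ∣-trans; ∣m⇒∣-m; ∣m∣n⇒∣m+n; ∣m∣n⇒∣m-n; ∣m+n∣n⇒∣m; ∣n⇒∣m*n;
         *-cancelˡ-∣)
open import Data.Integer.DivMod using (_%ℕ_; _/ℕ_; n%ℕd<d; a≡a%ℕn+[a/ℕn]*n)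
import Data.Integer.Properties as ℤ
open import Data.Integer.Tactic.RingSolver using (solve-∀)
open import Data.Nat as ℕ using (ℕ; zero; suc; _<_; _≤_; _*_; z≤n; s≤s; NonZero)
import Data.Nat.Divisibility as ℕ
open import Data.Nat.DivMod using (_%_; _/_; m<n⇒m%n≡m; m≡m%n+[m/n]*n; n%n≡0)
import Data.Nat.Properties as ℕ
open import Data.Product using (Σ; ∃; _×_; _,_; proj₁; proj₂; map; uncurry)
open import Data.Sum using (_⊎_; inj₁; inj₂; [_,_]′; swap)
open import Function using (_∘_; id)
open import Function.Bundles using (_↔_; Inverse; Equivalence; mk↔ₛ′; mk⇔)
open import Function.Definitions using (Injective)
open import Level using (0ℓ)
open import Relation.Binary.Bundles using (Setoid)
open import Relation.Binary.Construct.Closure.ReflexiveTransitive using (Star; ε; _◅_; _◅◅_; revApp; reverse)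
open import Relation.Binary.PropositionalEquality
import Relation.Binary.Reasoning.Setoid as SetoidReasoning
open import Relation.Binary.Structures using (IsEquivalence)
open import Relation.Nullary using (yes; no; contradiction)
open import Algebra.Properties.Monoid.Sum ℤ.+-0-monoid using (sum)
module ℕ+ = CommutativeSemigroupProperties ℕ.+-commutativeSemigroup
module ℤ+ = CommutativeSemigroupProperties ℤ.+-commutativeSemigroup
open import Defs

module Modular (n : ℕ) .{{_ : NonZero n}} where

  infix 4 _≈_
  record _≈_ (a b : ℤ) : Set where
    constructor mk≈
    field n∣a-b : + n ∣ a - b

  ≈-reflexive : ∀ {a b} → a ≡ b → a ≈ b
  ≈-reflexive {a} refl = mk≈ (divides 0ℤ (ℤ.+-inverseʳ a))

  ≈-sym : ∀ {a b} → a ≈ b → b ≈ a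
  ≈-sym {a} {b} (mk≈ a≈b) = mk≈ (subst (+ n ∣_) (neg-diff a b) (∣m⇒∣-m a≈b))
    where
    neg-diff : ∀ a b → - (a - b) ≡ b - a
    neg-diff = solve-∀

  ≈-trans : ∀ {a b c} → a ≈ b → b ≈ c → a ≈ c
  ≈-trans {a} {b} {c} (mk≈ a≈b) (mk≈ b≈c) = mk≈ (subst (+ n ∣_) (telescope a b c) (∣m∣n⇒∣m+n a≈b b≈c))
    where
    telescope : ∀ a b c → a - b + (b - c) ≡ a - c
    telescope = solve-∀

  ≈-isEquivalence : IsEquivalence _≈_
  ≈-isEquivalence = record { refl = ≈-reflexive refl ; sym = ≈-sym ; trans = ≈-trans }

  ≈-setoid : Setoid 0ℓ 0ℓ
  ≈-setoid = record { isEquivalence = ≈-isEquivalence }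

  module ≈-Reasoning = SetoidReasoning ≈-setoid

  +-congʳ-≈ : ∀ {a b} c → a ≈ b → a + c ≈ b + c
  +-congʳ-≈ {a} {b} c (mk≈ a≈b) = mk≈ (subst (+ n ∣_) (cancel a b c) a≈b)
    where
    cancel : ∀ a b c → a - b ≡ a + c - (b + c)
    cancel = solve-∀

  +-congˡ-≈ : ∀ {a b} c → a ≈ b → c + a ≈ c + b
  +-congˡ-≈ {a} {b} c (mk≈ a≈b) = mk≈ (subst (+ n ∣_) (cancel a b c) a≈b)
    where
    cancel : ∀ a b c → a - b ≡ c + a - (c + b)
    cancel = solve-∀

  +-cancelˡ-≈ : ∀ c {a b} → c + a ≈ c + b → a ≈ b
  +-cancelˡ-≈ c {a} {b} (mk≈ n∣diff) = mk≈ (subst (+ n ∣_) (cancel a b c) n∣diff)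
    where
    cancel : ∀ a b c → c + a - (c + b) ≡ a - b
    cancel = solve-∀

  ∣ᵤ⇒≈0 : ∀ {a} → + n ℤᵤ.∣ a → a ≈ 0ℤ
  ∣ᵤ⇒≈0 {a} n∣a = mk≈ (subst (+ n ∣_) (sym (ℤ.+-identityʳ a)) (∣ᵤ⇒∣ n∣a))

  ≈0⇒∣ᵤ : ∀ {a} → a ≈ 0ℤ → + n ℤᵤ.∣ a
  ≈0⇒∣ᵤ {a} (mk≈ n∣a-0) = ∣⇒∣ᵤ (subst (+ n ∣_) (ℤ.+-identityʳ a) n∣a-0)

  ≈-moveʳ : ∀ {a b} s → a ≈ b + s → b ≈ a - s
  ≈-moveʳ {a} {b} s a≈b+s = ≈-trans (≈-reflexive (cancel b s)) (+-congʳ-≈ (- s) (≈-sym a≈b+s))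
    where
    cancel : ∀ b s → b ≡ b + s - s
    cancel = solve-∀

  ≈-moveʳ⁻ : ∀ {a b} s → a ≈ b - s → b ≈ a + s
  ≈-moveʳ⁻ {a} {b} s a≈b-s = subst (λ t → b ≈ a + t) (ℤ.neg-involutive s) (≈-moveʳ (- s) a≈b-s)

  -- Opaque: unfolding the residue into ℤ-arithmetic makes unification blow up.
  opaque
    ⟦_⟧ : ℤ → Fin n
    ⟦ a ⟧ = fromℕ< (n%ℕd<d a n)

    toℕ-⟦⟧ : ∀ a → toℕ ⟦ a ⟧ ≡ a %ℕ n
    toℕ-⟦⟧ a = Fin.toℕ-fromℕ< _

  residue-unique : ∀ {r s} → r < n → s < n → + n ∣ + r - + s → r ≡ s
  residue-unique {r} {s} r<n s<n n∣r-s = ℤ.+-injective (ℤ.i-j≡0⇒i≡j (+ r) (+ s) (ℤ.∣i∣≡0⇒i≡0 distance≡0))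
    where
    distance<n : ∣ + r - + s ∣ < n
    distance<n = subst (_< n) (cong ∣_∣ (sym (ℤ.[+m]-[+n]≡m⊖n r s)))
                       (ℕ.≤-<-trans (ℤ.∣m⊝n∣≤m⊔n r s) (ℕ.⊔-pres-<m r<n s<n))
    distance≡0 : ∣ + r - + s ∣ ≡ 0
    distance≡0 = trans (sym (m<n⇒m%n≡m distance<n)) (ℕ.n∣m⇒m%n≡0 _ n (∣⇒∣ᵤ n∣r-s))

  residue≈ : ∀ a → + (a %ℕ n) ≈ a
  residue≈ a = mk≈ (divides (- (a /ℕ n)) (subst (λ a′ → + (a %ℕ n) - a′ ≡ - (a /ℕ n) · + n)
                                         (sym (a≡a%ℕn+[a/ℕn]*n a n)) (cancel (+ (a %ℕ n)) (a /ℕ n) (+ n))))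
    where
    cancel : ∀ r q m → r - (r + q · m) ≡ - q · m
    cancel = solve-∀

  toℕ⟦⟧≈ : ∀ a → + toℕ ⟦ a ⟧ ≈ a
  toℕ⟦⟧≈ a = subst (λ r → + r ≈ a) (sym (toℕ-⟦⟧ a)) (residue≈ a)

  ⟦⟧-cong : ∀ {a b} → a ≈ b → ⟦ a ⟧ ≡ ⟦ b ⟧
  ⟦⟧-cong {a} {b} a≈b = Fin.toℕ-injective (residue-unique (Fin.toℕ<n ⟦ a ⟧) (Fin.toℕ<n ⟦ b ⟧)
    (_≈_.n∣a-b (≈-trans (toℕ⟦⟧≈ a) (≈-trans a≈b (≈-sym (toℕ⟦⟧≈ b))))))

  ⟦⟧-injective : ∀ {a b} → ⟦ a ⟧ ≡ ⟦ b ⟧ → a ≈ b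
  ⟦⟧-injective {a} {b} eq = ≈-trans (≈-sym (toℕ⟦⟧≈ a)) (subst (λ x → + toℕ x ≈ b) (sym eq) (toℕ⟦⟧≈ b))

  ⟦toℕ⟧ : ∀ x → ⟦ + toℕ x ⟧ ≡ x
  ⟦toℕ⟧ x = Fin.toℕ-injective (trans (toℕ-⟦⟧ (+ toℕ x)) (m<n⇒m%n≡m (Fin.toℕ<n x)))

  multiplier-mod-order : ∀ {k g} .{{_ : NonZero k}} → + k · g ≈ 0ℤ → ∀ x → + (x % k) · g ≈ + x · g
  multiplier-mod-order {k} {g} (mk≈ n∣kg-0) x = mk≈ (subst (+ n ∣_) (begin
      - (+ (x / k) · (+ k · g - 0ℤ))                    ≡⟨ split (+ (x % k)) (+ (x / k)) (+ k) g ⟩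
      + (x % k) · g - (+ (x % k) + + (x / k) · + k) · g ≡⟨ cong (λ y → + (x % k) · g - y · g) (sym divMod) ⟩
      + (x % k) · g - + x · g                           ∎)
    (∣m⇒∣-m (∣n⇒∣m*n (+ (x / k)) n∣kg-0)))
    where
    open ≡-Reasoning
    split : ∀ r q k g → - (q · (k · g - 0ℤ)) ≡ r · g - (r + q · k) · g
    split = solve-∀
    divMod : + x ≡ + (x % k) + + (x / k) · + k
    divMod = trans (cong +_ (m≡m%n+[m/n]*n x k))
                   (trans (ℤ.pos-+ (x % k) _) (cong (_+_ (+ (x % k))) (ℤ.pos-* (x / k) k)))

module _ (n′ : ℕ) where
  open Modular (suc n′)

  next-⟦⟧ : ∀ a → next ⟦ a ⟧ ≡ ⟦ a + 1ℤ ⟧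
  next-⟦⟧ a = begin
    next ⟦ a ⟧   ≡⟨ Fin.toℕ-injective (trans (Fin.toℕ-fromℕ< _) (sym (toℕ-⟦⟧ (+ suc x)))) ⟩
    ⟦ + suc x ⟧  ≡⟨ cong (λ y → ⟦ + y ⟧) (ℕ.+-comm 1 x) ⟩
    ⟦ + x + 1ℤ ⟧ ≡⟨ ⟦⟧-cong (+-congʳ-≈ 1ℤ (toℕ⟦⟧≈ a)) ⟩
    ⟦ a + 1ℤ ⟧   ∎
    where
    open ≡-Reasoning
    x = toℕ ⟦ a ⟧

toℕ-next-< : ∀ {L} (i : Fin L) → suc (toℕ i) < L → toℕ (next i) ≡ suc (toℕ i)
toℕ-next-< {suc L} i i+1<L = trans (Fin.toℕ-fromℕ< _) (m<n⇒m%n≡m i+1<L)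

toℕ-next-last : ∀ {L} (i : Fin L) → suc (toℕ i) ≡ L → toℕ (next i) ≡ 0
toℕ-next-last {suc L} i i+1≡L = trans (Fin.toℕ-fromℕ< _) (trans (cong (_% suc L) i+1≡L) (n%n≡0 (suc L)))

toℕ-next : ∀ {L} .{{_ : NonZero L}} (i : Fin L) → toℕ (next i) ≡ suc (toℕ i) % L
toℕ-next {suc L} i = Fin.toℕ-fromℕ< _

inner-or-last : ∀ {L} (i : Fin L) → suc (toℕ i) < L ⊎ suc (toℕ i) ≡ L
inner-or-last i = ℕ.m≤n⇒m<n∨m≡n (Fin.toℕ<n i)

module _ {k m : ℕ} (u : Fin k) (j : Fin m) where

  next-combine-inner : suc (toℕ j) < m → next (combine u j) ≡ combine u (next j)
  next-combine-inner j+1<m = Fin.toℕ-injective (begin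
    toℕ (next (combine u j)) ≡⟨ toℕ-next-< (combine u j) inside ⟩
    suc (toℕ (combine u j))  ≡⟨ step ⟩
    toℕ (combine u (next j)) ∎)
    where
    open ≡-Reasoning
    step : suc (toℕ (combine u j)) ≡ toℕ (combine u (next j))
    step = begin
      suc (toℕ (combine u j))    ≡⟨ cong suc (Fin.toℕ-combine u j) ⟩
      suc (m * toℕ u ℕ.+ toℕ j)  ≡⟨ ℕ.+-suc (m * toℕ u) (toℕ j) ⟨
      m * toℕ u ℕ.+ suc (toℕ j)  ≡⟨ cong (m * toℕ u ℕ.+_) (toℕ-next-< j j+1<m) ⟨
      m * toℕ u ℕ.+ toℕ (next j) ≡⟨ Fin.toℕ-combine u (next j) ⟨
      toℕ (combine u (next j))   ∎
    inside : suc (toℕ (combine u j)) < k * m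
    inside = subst (_< k * m) (sym step) (Fin.toℕ<n (combine u (next j)))

  next-combine-last : suc (toℕ j) ≡ m → next (combine u j) ≡ combine (next u) (next j)
  next-combine-last j+1≡m = Fin.toℕ-injective (carry (inner-or-last u))
    where
    open ≡-Reasoning
    combine-suc : suc (toℕ (combine u j)) ≡ m * suc (toℕ u)
    combine-suc = begin
      suc (toℕ (combine u j))   ≡⟨ cong suc (Fin.toℕ-combine u j) ⟩
      suc (m * toℕ u ℕ.+ toℕ j) ≡⟨ ℕ.+-suc (m * toℕ u) (toℕ j) ⟨
      m * toℕ u ℕ.+ suc (toℕ j) ≡⟨ cong (m * toℕ u ℕ.+_) j+1≡m ⟩
      m * toℕ u ℕ.+ m           ≡⟨ ℕ.+-comm (m * toℕ u) m ⟩
      m ℕ.+ m * toℕ u           ≡⟨ ℕ.*-suc m (toℕ u) ⟨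
      m * suc (toℕ u)           ∎
    combine-next : toℕ (combine (next u) (next j)) ≡ m * toℕ (next u)
    combine-next = begin
      toℕ (combine (next u) (next j))   ≡⟨ Fin.toℕ-combine (next u) (next j) ⟩
      m * toℕ (next u) ℕ.+ toℕ (next j) ≡⟨ cong (m * toℕ (next u) ℕ.+_) (toℕ-next-last j j+1≡m) ⟩
      m * toℕ (next u) ℕ.+ 0            ≡⟨ ℕ.+-identityʳ _ ⟩
      m * toℕ (next u)                  ∎
    carry : suc (toℕ u) < k ⊎ suc (toℕ u) ≡ k → toℕ (next (combine u j)) ≡ toℕ (combine (next u) (next j))
    carry (inj₁ u+1<k) = begin
      toℕ (next (combine u j))        ≡⟨ toℕ-next-< (combine u j) inside ⟩
      suc (toℕ (combine u j))         ≡⟨ lifted ⟩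
      toℕ (combine (next u) (next j)) ∎
      where
      lifted : suc (toℕ (combine u j)) ≡ toℕ (combine (next u) (next j))
      lifted = trans combine-suc (trans (cong (m *_) (sym (toℕ-next-< u u+1<k))) (sym combine-next))
      inside : suc (toℕ (combine u j)) < k * m
      inside = subst (_< k * m) (sym lifted) (Fin.toℕ<n (combine (next u) (next j)))
    carry (inj₂ u+1≡k) = begin
      toℕ (next (combine u j))        ≡⟨ toℕ-next-last (combine u j) wraps ⟩
      0                               ≡⟨ ℕ.*-zeroʳ m ⟨
      m * 0                           ≡⟨ cong (m *_) (toℕ-next-last u u+1≡k) ⟨
      m * toℕ (next u)                ≡⟨ combine-next ⟨
      toℕ (combine (next u) (next j)) ∎
      where
      wraps : suc (toℕ (combine u j)) ≡ k * m
      wraps = trans combine-suc (trans (cong (m *_) u+1≡k) (ℕ.*-comm m k))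

prefixSum : ∀ {m} → (Fin m → ℤ) → Fin m → ℤ
prefixSum e zero    = 0ℤ
prefixSum e (suc j) = e zero + prefixSum (e ∘ suc) j

prefixSum-zero : ∀ {m} (e : Fin m → ℤ) j → toℕ j ≡ 0 → prefixSum e j ≡ 0ℤ
prefixSum-zero e zero _ = refl

prefixSum-step : ∀ {m} (e : Fin m → ℤ) j j′ → toℕ j′ ≡ suc (toℕ j) → prefixSum e j′ ≡ prefixSum e j + e j
prefixSum-step e zero    (suc j′) j′≡1 = begin
  e zero + prefixSum (e ∘ suc) j′ ≡⟨ cong (_+_ (e zero)) (prefixSum-zero (e ∘ suc) j′ (ℕ.suc-injective j′≡1)) ⟩
  e zero + 0ℤ                     ≡⟨ ℤ.+-comm (e zero) 0ℤ ⟩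
  0ℤ + e zero                     ∎
  where open ≡-Reasoning
prefixSum-step e (suc j) (suc j′) j′≡j+1 = begin
  e zero + prefixSum (e ∘ suc) j′              ≡⟨ cong (_+_ (e zero)) (prefixSum-step (e ∘ suc) j j′ (ℕ.suc-injective j′≡j+1)) ⟩
  e zero + (prefixSum (e ∘ suc) j + e (suc j)) ≡⟨ ℤ.+-assoc (e zero) _ _ ⟨
  e zero + prefixSum (e ∘ suc) j + e (suc j)   ∎
  where open ≡-Reasoning

prefixSum-last : ∀ {m} (e : Fin m → ℤ) j → suc (toℕ j) ≡ m → prefixSum e j + e j ≡ sum e
prefixSum-last {suc zero}    e zero    _ = ℤ.+-comm 0ℤ (e zero)
prefixSum-last {suc (suc m)} e (suc j) j+1≡m = begin
  e zero + prefixSum (e ∘ suc) j + e (suc j)   ≡⟨ ℤ.+-assoc (e zero) _ _ ⟩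
  e zero + (prefixSum (e ∘ suc) j + e (suc j)) ≡⟨ cong (_+_ (e zero)) (prefixSum-last (e ∘ suc) j (ℕ.suc-injective j+1≡m)) ⟩
  e zero + sum (e ∘ suc)                       ∎
  where open ≡-Reasoning

-- C_n^+ shifts the ℤ_n-coordinate by +1, C_n^- by -1
shift : Bool → ℤ
shift false = 1ℤ
shift true  = -1ℤ

sum-shift : ∀ m (f : Fin m → Bool) → sum (shift ∘ f) ≡ + m - + (2 * countTrue m f)
sum-shift zero    f = refl
sum-shift (suc m) f with f zero
... | false = trans (cong (_+_ 1ℤ) (sum-shift m (f ∘ suc))) (plus-one (+ m) (+ (2 * countTrue m (f ∘ suc))))
  where
  plus-one : ∀ a b → 1ℤ + (a - b) ≡ 1ℤ + a - b
  plus-one = solve-∀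
... | true  = begin
  -1ℤ + sum (shift ∘ f ∘ suc) ≡⟨ cong (_+_ -1ℤ) (sum-shift m (f ∘ suc)) ⟩
  -1ℤ + (+ m - + (2 * c))     ≡⟨ minus-one (+ m) (+ (2 * c)) ⟩
  + suc m - + (2 ℕ.+ 2 * c)   ≡⟨ cong (λ x → + suc m - + x) (ℕ.*-suc 2 c) ⟨
  + suc m - + (2 * suc c)     ∎
  where
  open ≡-Reasoning
  c = countTrue m (f ∘ suc)
  minus-one : ∀ a x → -1ℤ + (a - x) ≡ 1ℤ + a - (+ 2 + x)
  minus-one = solve-∀

orient : Bool → ℤ → ℤ
orient true  a = a
orient false a = - a

IsSubgroupOrder-orient : ∀ {n g k} b → IsSubgroupOrder n g k → IsSubgroupOrder n (orient b g) k
IsSubgroupOrder-orient true  order = order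
IsSubgroupOrder-orient {n} {g} {k} false (0<k , n∣kg , minimal) =
  0<k , subst (n ℕ.∣_) (∣d·g∣≡∣d·-g∣ k) n∣kg ,
  λ d 0<d n∣d·-g → minimal d 0<d (subst (n ℕ.∣_) (sym (∣d·g∣≡∣d·-g∣ d)) n∣d·-g)
  where
  ∣d·g∣≡∣d·-g∣ : ∀ d → ∣ + d · g ∣ ≡ ∣ + d · - g ∣
  ∣d·g∣≡∣d·-g∣ d = trans (sym (ℤ.∣-i∣≡∣i∣ (+ d · g))) (cong ∣_∣ (ℤ.neg-distribʳ-* (+ d) g))

sum-orient : ∀ {m} b (f : Fin m → ℤ) → sum (orient b ∘ f) ≡ orient b (sum f)
sum-orient true  f = refl
sum-orient false f = sum-neg f
  where
  sum-neg : ∀ {m} (f : Fin m → ℤ) → sum (-_ ∘ f) ≡ - sum f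
  sum-neg {zero}  f = refl
  sum-neg {suc m} f =
    trans (cong (_+_ (- f zero)) (sum-neg (f ∘ suc))) (sym (ℤ.neg-distrib-+ (f zero) (sum (f ∘ suc))))

injective⇒surjective : ∀ {m n} (f : Fin m → Fin n) → m ≡ n → Injective _≡_ _≡_ f → ∀ y → ∃ λ x → f x ≡ y
injective⇒surjective {suc m} f refl f-inj y with Fin.any? (λ x → f x Fin.≟ y)
... | yes hit = hit
... | no miss = contradiction (Fin.injective⇒≤ punched-injective) (ℕ.<-irrefl refl)
  where
  punched : Fin (suc m) → Fin m
  punched x = Fin.punchOut {i = y} (λ y≡fx → miss (x , sym y≡fx))
  punched-injective : Injective _≡_ _≡_ punched
  punched-injective {x} {x′} =
    f-inj ∘ Fin.punchOut-injective (λ y≡fx → miss (x , sym y≡fx)) (λ y≡fx′ → miss (x′ , sym y≡fx′))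

remQuot-injective : ∀ {q} k → Injective _≡_ _≡_ (remQuot {q} k)
remQuot-injective {q} k {x} {y} eq =
  trans (sym (Fin.combine-remQuot {q} k x)) (trans (cong (uncurry combine) eq) (Fin.combine-remQuot {q} k y))

module CosetDecomposition (n q k : ℕ) .{{_ : NonZero n}} (q*k≡n : q * k ≡ n) (g : ℤ)
  (k·g≈0 : Modular._≈_ n (+ k · g) 0ℤ)
  (k-minimal : ∀ d → 0 < d → Modular._≈_ n (+ d · g) 0ℤ → k ≤ d) where

  open Modular n

  private instance
    q*k-nonZero : NonZero (q * k)
    q*k-nonZero = ℕ.≢-nonZero (λ q*k≡0 → ℕ.≢-nonZero⁻¹ n (trans (sym q*k≡n) q*k≡0))
    q-nonZero : NonZero q
    q-nonZero = ℕ.m*n≢0⇒m≢0 q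
    k-nonZero : NonZero k
    k-nonZero = ℕ.m*n≢0⇒n≢0 q

  q∣g : + q ∣ g
  q∣g = *-cancelˡ-∣ (+ k) (subst₂ _∣_ n≡k*q (ℤ.+-identityʳ (+ k · g)) (_≈_.n∣a-b k·g≈0))
    where
    n≡k*q : + n ≡ + k · + q
    n≡k*q = trans (cong +_ (trans (sym q*k≡n) (ℕ.*-comm q k))) (ℤ.pos-* k q)

  multiples-distinct : ∀ (u u′ : Fin k) → toℕ u ≤ toℕ u′ → + toℕ u · g ≈ + toℕ u′ · g → u ≡ u′
  multiples-distinct u u′ u≤u′ ug≈u′g with ℕ.m≤n⇒∃[o]m+o≡n u≤u′
  ... | zero  , u+0≡u′ = Fin.toℕ-injective (trans (sym (ℕ.+-identityʳ (toℕ u))) u+0≡u′)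
  ... | suc d , u+d≡u′ = contradiction (k-minimal (suc d) (s≤s z≤n) dg≈0) (ℕ.<⇒≱ d<k)
    where
    d<k : suc d < k
    d<k = ℕ.≤-<-trans (ℕ.m≤n+m (suc d) (toℕ u)) (subst (_< k) (sym u+d≡u′) (Fin.toℕ<n u′))
    difference : ∀ u d g → (u + d) · g - u · g ≡ d · g - 0ℤ
    difference = solve-∀
    u′g-ug≡dg : + toℕ u′ · g - + toℕ u · g ≡ + suc d · g - 0ℤ
    u′g-ug≡dg = begin
      + toℕ u′ · g - + toℕ u · g            ≡⟨ cong (λ x → + x · g - + toℕ u · g) u+d≡u′ ⟨
      + (toℕ u ℕ.+ suc d) · g - + toℕ u · g ≡⟨ cong (λ x → x · g - + toℕ u · g) (ℤ.pos-+ (toℕ u) (suc d)) ⟩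
      (+ toℕ u + + suc d) · g - + toℕ u · g ≡⟨ difference (+ toℕ u) (+ suc d) g ⟩
      + suc d · g - 0ℤ                      ∎
      where open ≡-Reasoning
    dg≈0 : + suc d · g ≈ 0ℤ
    dg≈0 = mk≈ (subst (+ n ∣_) u′g-ug≡dg (_≈_.n∣a-b (≈-sym ug≈u′g)))

  q∣n : + q ∣ + n
  q∣n = divides (+ k) (trans (cong +_ (trans (sym q*k≡n) (ℕ.*-comm q k))) (ℤ.pos-* k q))

  coset-representative-unique : ∀ {c c′ : Fin q} {x x′ : ℤ} → + toℕ c + x · g ≈ + toℕ c′ + x′ · g → c ≡ c′
  coset-representative-unique {c} {c′} {x} {x′} (mk≈ n∣diff) =
    Fin.toℕ-injective (Modular.residue-unique q (Fin.toℕ<n c) (Fin.toℕ<n c′) q∣c-c′)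
    where
    rearrange : ∀ c c′ y y′ → c + y - (c′ + y′) ≡ c - c′ + (y - y′)
    rearrange = solve-∀
    q∣c-c′ : + q ∣ + toℕ c - + toℕ c′
    q∣c-c′ = ∣m+n∣n⇒∣m (subst (+ q ∣_) (rearrange (+ toℕ c) (+ toℕ c′) (x · g) (x′ · g)) (∣-trans q∣n n∣diff))
                       (∣m∣n⇒∣m-n (∣n⇒∣m*n x q∣g) (∣n⇒∣m*n x′ q∣g))

  β : Fin q × Fin k → Fin n
  β (c , u) = ⟦ + toℕ c + + toℕ u · g ⟧

  β≡⇒≈ : ∀ {c u L} → β (c , u) ≡ ⟦ L ⟧ → + toℕ c + + toℕ u · g ≈ L
  β≡⇒≈ {c} {u} {L} = ⟦⟧-injective {+ toℕ c + + toℕ u · g} {L}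

  β-injectiveˡ : ∀ {c c′ u u′} → β (c , u) ≡ β (c′ , u′) → c ≡ c′
  β-injectiveˡ {c} {c′} {u} {u′} βeq =
    coset-representative-unique {c} {c′} {+ toℕ u} {+ toℕ u′} (β≡⇒≈ {c} {u} {+ toℕ c′ + + toℕ u′ · g} βeq)

  β-injectiveʳ : ∀ {c u u′} → β (c , u) ≡ β (c , u′) → u ≡ u′
  β-injectiveʳ {c} {u} {u′} βeq =
    [ (λ u≤u′ → multiples-distinct u u′ u≤u′ ug≈u′g)
    , (λ u′≤u → sym (multiples-distinct u′ u u′≤u (≈-sym ug≈u′g)))
    ]′ (ℕ.≤-total (toℕ u) (toℕ u′))
    where
    ug≈u′g : + toℕ u · g ≈ + toℕ u′ · g
    ug≈u′g = +-cancelˡ-≈ (+ toℕ c) {+ toℕ u · g} {+ toℕ u′ · g} (β≡⇒≈ {c} {u} {+ toℕ c + + toℕ u′ · g} βeq)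

  β-injective : Injective _≡_ _≡_ β
  β-injective {c , u} {c′ , u′} βeq =
    cong₂ _,_ c≡c′ (β-injectiveʳ {c} {u} {u′} (subst (λ c″ → β (c , u) ≡ β (c″ , u′)) (sym c≡c′) βeq))
    where
    c≡c′ : c ≡ c′
    c≡c′ = β-injectiveˡ {c} {c′} {u} {u′} βeq

  β∘remQuot-injective : Injective _≡_ _≡_ (β ∘ remQuot k)
  β∘remQuot-injective {x} {x′} eq = remQuot-injective k {x} {x′} (β-injective {remQuot k x} {remQuot k x′} eq)

  β-surjective : ∀ y → ∃ λ x → β x ≡ y
  β-surjective y = map (remQuot k) id (injective⇒surjective (β ∘ remQuot k) q*k≡n β∘remQuot-injective y)

  -- Opaque: β⁻¹ is an exhaustive search through Fin n that must never be unfolded.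
  opaque
    β⁻¹ : Fin n → Fin q × Fin k
    β⁻¹ = proj₁ ∘ β-surjective

    β-β⁻¹ : ∀ y → β (β⁻¹ y) ≡ y
    β-β⁻¹ = proj₂ ∘ β-surjective

  β⁻¹-β : ∀ x → β⁻¹ (β x) ≡ x
  β⁻¹-β x = β-injective {β⁻¹ (β x)} {x} (β-β⁻¹ (β x))

  β⁻¹-offset : ∀ L → let (c , u) = β⁻¹ ⟦ L ⟧ in + toℕ c + + toℕ u · g ≈ L
  β⁻¹-offset L = β≡⇒≈ {proj₁ (β⁻¹ ⟦ L ⟧)} {proj₂ (β⁻¹ ⟦ L ⟧)} {L} (β-β⁻¹ ⟦ L ⟧)

remainder-combine : ∀ {k m} (u : Fin k) (j : Fin m) → remainder {k} m (combine u j) ≡ j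
remainder-combine u j = cong proj₂ (Fin.remQuot-combine u j)

quotient-combine : ∀ {k m} (u : Fin k) (j : Fin m) → quotient {k} m (combine u j) ≡ u
quotient-combine u j = cong proj₁ (Fin.remQuot-combine u j)

Σ-transport : ∀ {A B : Set} {C : B → Set} {f : A → B} {a a′ : A} (e : a′ ≡ a) (e′ : f a′ ≡ f a) (x : C (f a)) →
              _≡_ {A = Σ A (C ∘ f)} (a′ , subst C (sym e′) x) (a , x)
Σ-transport refl refl x = refl

subst-rel : ∀ {A : Set} {B : A → Set} (R : ∀ a → B a → B a → Set) {a a′ : A} (e : a′ ≡ a) {x y : B a} →
            R a x y → R a′ (subst B (sym e) x) (subst B (sym e) y)
subst-rel R refl r = r

combine-remQuot-Σ : ∀ {k m} {B : Fin m → Set} (p : Fin (k * m)) (x : B (remainder {k} m p)) →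
  _≡_ {A = Σ (Fin (k * m)) (B ∘ remainder {k} m)}
      (combine (quotient {k} m p) (remainder {k} m p) , subst B (sym (remainder-combine (quotient {k} m p) (remainder {k} m p))) x)
      (p , x)
combine-remQuot-Σ {k} {m} p = Σ-transport (Fin.combine-remQuot {k} m p) (remainder-combine (quotient {k} m p) (remainder {k} m p))

module Winding (n k m : ℕ) .{{_ : NonZero n}} .{{_ : NonZero k}} (e : Fin m → ℤ)
  (k·G≈0 : Modular._≈_ n (+ k · sum e) 0ℤ) where

  open Modular n

  G : ℤ
  G = sum e

  quot : Fin (k * m) → Fin k
  quot = quotient m

  rem : Fin (k * m) → Fin m
  rem = remainder {k} m

  height : Fin (k * m) → ℤ
  height p = + toℕ (quot p) · G + prefixSum e (rem p)

  height-combine : ∀ (u : Fin k) (j : Fin m) → height (combine u j) ≡ + toℕ u · G + prefixSum e j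
  height-combine u j = cong₂ (λ u′ j′ → + toℕ u′ · G + prefixSum e j′) (quotient-combine u j) (remainder-combine u j)

  private
    remainder-next-combine : ∀ (u : Fin k) (j : Fin m) → rem (next (combine u j)) ≡ next j
    remainder-next-combine u j with inner-or-last j
    ... | inj₁ j+1<m = trans (cong rem (next-combine-inner u j j+1<m)) (remainder-combine u (next j))
    ... | inj₂ j+1≡m = trans (cong rem (next-combine-last u j j+1≡m)) (remainder-combine (next u) (next j))

    height-next-combine : ∀ (u : Fin k) (j : Fin m) → height (next (combine u j)) ≈ height (combine u j) + e j
    height-next-combine u j with inner-or-last j
    ... | inj₁ j+1<m = ≈-reflexive (begin
      height (next (combine u j))         ≡⟨ cong height (next-combine-inner u j j+1<m) ⟩
      height (combine u (next j))         ≡⟨ height-combine u (next j) ⟩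
      + toℕ u · G + prefixSum e (next j)  ≡⟨ cong (_+_ (+ toℕ u · G)) (prefixSum-step e j (next j) (toℕ-next-< j j+1<m)) ⟩
      + toℕ u · G + (prefixSum e j + e j) ≡⟨ ℤ.+-assoc (+ toℕ u · G) _ _ ⟨
      + toℕ u · G + prefixSum e j + e j   ≡⟨ cong (_+ e j) (height-combine u j) ⟨
      height (combine u j) + e j          ∎)
      where open ≡-Reasoning
    -- at the end of a block u advances modulo k, which costs nothing since k·G ≈ 0
    ... | inj₂ j+1≡m = begin
      height (next (combine u j))               ≡⟨ cong height (next-combine-last u j j+1≡m) ⟩
      height (combine (next u) (next j))        ≡⟨ height-combine (next u) (next j) ⟩
      + toℕ (next u) · G + prefixSum e (next j) ≡⟨ cong (_+_ (+ toℕ (next u) · G)) (prefixSum-zero e (next j) (toℕ-next-last j j+1≡m)) ⟩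
      + toℕ (next u) · G + 0ℤ                   ≡⟨ ℤ.+-identityʳ _ ⟩
      + toℕ (next u) · G                        ≡⟨ cong (λ x → + x · G) (toℕ-next u) ⟩
      + (suc (toℕ u) ℕ.% k) · G                 ≈⟨ multiplier-mod-order {k} {G} k·G≈0 (suc (toℕ u)) ⟩
      + suc (toℕ u) · G                         ≡⟨ unfold-suc (toℕ u) ⟩
      + toℕ u · G + G                           ≡⟨ cong (_+_ (+ toℕ u · G)) (prefixSum-last e j j+1≡m) ⟨
      + toℕ u · G + (prefixSum e j + e j)       ≡⟨ ℤ.+-assoc (+ toℕ u · G) _ _ ⟨
      + toℕ u · G + prefixSum e j + e j         ≡⟨ cong (_+ e j) (height-combine u j) ⟨
      height (combine u j) + e j                ∎
      where
      open ≈-Reasoning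
      unfold-suc : ∀ x → + suc x · G ≡ + x · G + G
      unfold-suc x = trans (cong (λ y → + y · G) (ℕ.+-comm 1 x)) (distrib (+ x) G)
        where
        distrib : ∀ x g → (x + 1ℤ) · g ≡ x · g + g
        distrib = solve-∀

  remainder-next : ∀ p → rem (next p) ≡ next (rem p)
  remainder-next p = subst (λ p → rem (next p) ≡ next (rem p)) (Fin.combine-remQuot {k} m p)
    (trans (remainder-next-combine (quot p) (rem p)) (cong next (sym (remainder-combine (quot p) (rem p)))))

  height-next : ∀ p → height (next p) ≈ height p + e (rem p)
  height-next p = subst (λ p → height (next p) ≈ height p + e (rem p)) (Fin.combine-remQuot {k} m p)
    (subst (λ j → height (next (combine (quot p) (rem p))) ≈ height (combine (quot p) (rem p)) + e j)
           (sym (remainder-combine (quot p) (rem p)))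
           (height-next-combine (quot p) (rem p)))

module _ {N : ℕ} {adj : Adj N} where

  length : ∀ {x y} → Star adj x y → ℕ
  length ε       = 0
  length (_ ◅ ω) = suc (length ω)

  length-◅◅ : ∀ {x y z} (ω : Star adj x y) (ω′ : Star adj y z) → length (ω ◅◅ ω′) ≡ length ω ℕ.+ length ω′
  length-◅◅ ε       ω′ = refl
  length-◅◅ (_ ◅ ω) ω′ = cong suc (length-◅◅ ω ω′)

  -- beyond the length of the walk: its endpoint
  vertexAt : ∀ {x y} → Star adj x y → ℕ → Fin N
  vertexAt {x} ε       _       = x
  vertexAt {x} (_ ◅ _) zero    = x
  vertexAt     (_ ◅ ω) (suc t) = vertexAt ω t

  vertexAt-zero : ∀ {x y} (ω : Star adj x y) → vertexAt ω 0 ≡ x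
  vertexAt-zero ε       = refl
  vertexAt-zero (_ ◅ _) = refl

  vertexAt-length : ∀ {x y} (ω : Star adj x y) → vertexAt ω (length ω) ≡ y
  vertexAt-length ε       = refl
  vertexAt-length (_ ◅ ω) = vertexAt-length ω

  vertexAt-adj : ∀ {x y} (ω : Star adj x y) t → t < length ω → adj (vertexAt ω t) (vertexAt ω (suc t))
  vertexAt-adj (e ◅ ω) zero    _           = subst (adj _) (sym (vertexAt-zero ω)) e
  vertexAt-adj (_ ◅ ω) (suc t) (s≤s t<len) = vertexAt-adj ω t t<len

  splitAt : ∀ {x y} (ω : Star adj x y) t → t ≤ length ω →
            Σ (Star adj x (vertexAt ω t)) λ ω₁ → Σ (Star adj (vertexAt ω t) y) λ ω₂ →
              length ω₁ ≡ t × ω₁ ◅◅ ω₂ ≡ ω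
  splitAt ε       zero    _          = ε , ε , refl , refl
  splitAt (e ◅ ω) zero    _          = ε , e ◅ ω , refl , refl
  splitAt (e ◅ ω) (suc t) (s≤s t≤len) with splitAt ω t t≤len
  ... | ω₁ , ω₂ , len≡t , ω₁ω₂≡ω = e ◅ ω₁ , ω₂ , cong suc len≡t , cong (e ◅_) ω₁ω₂≡ω

  Simple : ∀ {x y} → Star adj x y → Set
  Simple ω = ∀ a b → a < length ω → b < length ω → vertexAt ω a ≡ vertexAt ω b → a ≡ b

  record Revisits {x y} (ω : Star adj x y) : Set where
    field
      {z}           : Fin N
      prefix        : Star adj x z
      loop          : Star adj z z
      suffix        : Star adj z y
      nonempty-loop : 0 < length loop
      nonempty-rest : 0 < length (prefix ◅◅ suffix)
      decomposition : prefix ◅◅ loop ◅◅ suffix ≡ ω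

  revisits-shorter : ∀ {x y} {ω : Star adj x y} (r : Revisits ω) → let open Revisits r in
                     length loop < length ω × length (prefix ◅◅ suffix) < length ω
  revisits-shorter {ω = ω} r = subst (length loop <_) length-ω (ℕ.m<m+n (length loop) nonempty-rest)
                             , subst (length (prefix ◅◅ suffix) <_) (trans (ℕ.+-comm _ (length loop)) length-ω)
                                     (ℕ.m<m+n (length (prefix ◅◅ suffix)) nonempty-loop)
    where
    open Revisits r
    length-ω : length loop ℕ.+ length (prefix ◅◅ suffix) ≡ length ω
    length-ω = begin
      length loop ℕ.+ length (prefix ◅◅ suffix)         ≡⟨ cong (length loop ℕ.+_) (length-◅◅ prefix suffix) ⟩
      length loop ℕ.+ (length prefix ℕ.+ length suffix) ≡⟨ ℕ+.x∙yz≈y∙xz (length loop) (length prefix) (length suffix) ⟩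
      length prefix ℕ.+ (length loop ℕ.+ length suffix) ≡⟨ cong (length prefix ℕ.+_) (length-◅◅ loop suffix) ⟨
      length prefix ℕ.+ length (loop ◅◅ suffix)         ≡⟨ length-◅◅ prefix (loop ◅◅ suffix) ⟨
      length (prefix ◅◅ loop ◅◅ suffix)                 ≡⟨ cong length decomposition ⟩
      length ω                                          ∎
      where open ≡-Reasoning

  simple-or-revisits : ∀ {x y} (ω : Star adj x y) → Simple ω ⊎ Revisits ω
  simple-or-revisits ε = inj₁ (λ _ _ ())
  simple-or-revisits (e ◅ ω) with simple-or-revisits ω
  ... | inj₂ r = inj₂ (record
    { prefix = e ◅ prefix ; loop = loop ; suffix = suffix
    ; nonempty-loop = nonempty-loop ; nonempty-rest = s≤s z≤n
    ; decomposition = cong (e ◅_) decomposition })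
    where open Revisits r
  simple-or-revisits {x} (e ◅ ω) | inj₁ ω-simple with Fin.any? (λ (i : Fin (length ω)) → vertexAt ω (toℕ i) Fin.≟ x)
  ... | yes (i , ωᵢ≡x) with splitAt ω (toℕ i) (ℕ.<⇒≤ (Fin.toℕ<n i))
  ...   | ω₁ , ω₂ , len≡i , ω₁ω₂≡ω =
    inj₂ (close-loop ωᵢ≡x ω₁ ω₂ ω₁ω₂≡ω (subst (_< length ω) (sym len≡i) (Fin.toℕ<n i)))
    where
    close-loop : ∀ {v} → v ≡ x → (ω₁ : Star adj _ v) (ω₂ : Star adj v _) → ω₁ ◅◅ ω₂ ≡ ω →
                 length ω₁ < length ω → Revisits (e ◅ ω)
    close-loop refl ω₁ ω₂ refl len< = record
      { prefix = ε ; loop = e ◅ ω₁ ; suffix = ω₂ ; nonempty-loop = s≤s z≤n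
      ; nonempty-rest = ℕ.+-cancelˡ-< (length ω₁) 0 (length ω₂)
                          (subst₂ _<_ (sym (ℕ.+-identityʳ (length ω₁))) (length-◅◅ ω₁ ω₂) len<)
      ; decomposition = refl }
  simple-or-revisits {x} (e ◅ ω) | inj₁ ω-simple | no x∉ω = inj₁ simple
    where
    visit : ∀ {t} (t<len : t < length ω) → vertexAt ω t ≡ x → ∃ λ (i : Fin (length ω)) → vertexAt ω (toℕ i) ≡ x
    visit t<len ωₜ≡x = fromℕ< t<len , trans (cong (vertexAt ω) (Fin.toℕ-fromℕ< t<len)) ωₜ≡x
    simple : Simple (e ◅ ω)
    simple zero    zero    _           _           _  = refl
    simple zero    (suc b) _           (s≤s b<len) eq = ⊥-elim (x∉ω (visit b<len (sym eq)))
    simple (suc a) zero    (s≤s a<len) _           eq = ⊥-elim (x∉ω (visit a<len eq))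
    simple (suc a) (suc b) (s≤s a<len) (s≤s b<len) eq = cong suc (ω-simple a b a<len b<len eq)

  simple-cycle : ∀ {x} (ω : Star adj x x) → Simple ω → 3 ≤ length ω → HasCycle adj
  simple-cycle ω simple 3≤len = record
    { L = length ω ; 3≤L = 3≤len ; c = c
    ; c-inj = λ p p′ cp≡cp′ → Fin.toℕ-injective (simple (toℕ p) (toℕ p′) (Fin.toℕ<n p) (Fin.toℕ<n p′) cp≡cp′)
    ; c-adj = λ p → subst (adj (c p)) (sym (c-next p)) (vertexAt-adj ω (toℕ p) (Fin.toℕ<n p)) }
    where
    c : Fin (length ω) → Fin N
    c p = vertexAt ω (toℕ p)
    c-next : ∀ p → c (next p) ≡ vertexAt ω (suc (toℕ p))
    c-next p with inner-or-last p
    ... | inj₁ p+1<len = cong (vertexAt ω) (toℕ-next-< p p+1<len)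
    ... | inj₂ p+1≡len = begin
      vertexAt ω (toℕ (next p)) ≡⟨ cong (vertexAt ω) (toℕ-next-last p p+1≡len) ⟩
      vertexAt ω 0              ≡⟨ vertexAt-zero ω ⟩
      _                         ≡⟨ vertexAt-length ω ⟨
      vertexAt ω (length ω)     ≡⟨ cong (vertexAt ω) p+1≡len ⟨
      vertexAt ω (suc (toℕ p))  ∎
      where open ≡-Reasoning

module TreePotential {N : ℕ} {adj : Adj N} (tree : IsTree adj) (s : ∀ {x y} → adj x y → ℤ)
  (s-anti : ∀ {x y} (e : adj x y) (e′ : adj y x) → s e′ ≡ - s e) where

  open IsTree tree renaming (sym to adj-sym)

  flip-edge : ∀ {x y} → adj x y → adj y x
  flip-edge = adj-sym _ _

  weight : ∀ {x y} → Star adj x y → ℤ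
  weight ε       = 0ℤ
  weight (e ◅ ω) = s e + weight ω

  weight-◅◅ : ∀ {x y z} (ω : Star adj x y) (ω′ : Star adj y z) → weight (ω ◅◅ ω′) ≡ weight ω + weight ω′
  weight-◅◅ ε       ω′ = sym (ℤ.+-identityˡ (weight ω′))
  weight-◅◅ (e ◅ ω) ω′ =
    trans (cong (_+_ (s e)) (weight-◅◅ ω ω′)) (sym (ℤ.+-assoc (s e) (weight ω) (weight ω′)))

  weight-revApp : ∀ {x y z} (ω : Star adj y x) (ω′ : Star adj y z) →
                  weight (revApp flip-edge ω ω′) ≡ - weight ω + weight ω′
  weight-revApp ε       ω′ = sym (ℤ.+-identityˡ (weight ω′))
  weight-revApp (e ◅ ω) ω′ = begin
    weight (revApp flip-edge ω (flip-edge e ◅ ω′)) ≡⟨ weight-revApp ω (flip-edge e ◅ ω′) ⟩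
    - weight ω + (s (flip-edge e) + weight ω′)     ≡⟨ cong (λ a → - weight ω + (a + weight ω′)) (s-anti e (flip-edge e)) ⟩
    - weight ω + (- s e + weight ω′)               ≡⟨ regroup (weight ω) (s e) (weight ω′) ⟩
    - (s e + weight ω) + weight ω′                 ∎
    where
    open ≡-Reasoning
    regroup : ∀ a b c → - a + (- b + c) ≡ - (b + a) + c
    regroup = solve-∀

  weight-reverse : ∀ {x y} (ω : Star adj x y) → weight (reverse flip-edge ω) ≡ - weight ω
  weight-reverse ω = trans (weight-revApp ω ε) (ℤ.+-identityʳ (- weight ω))

  simple-closed-weight : ∀ {x} (ω : Star adj x x) → Simple ω → weight ω ≡ 0ℤ
  simple-closed-weight ε                   _      = refl
  simple-closed-weight (e ◅ ε)             _      = ⊥-elim (irrefl _ e)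
  simple-closed-weight (e ◅ e′ ◅ ε)        _      = begin
    s e + (s e′ + 0ℤ)  ≡⟨ cong (λ a → s e + (a + 0ℤ)) (s-anti e e′) ⟩
    s e + (- s e + 0ℤ) ≡⟨ cancel (s e) ⟩
    0ℤ                 ∎
    where
    open ≡-Reasoning
    cancel : ∀ a → a + (- a + 0ℤ) ≡ 0ℤ
    cancel = solve-∀
  simple-closed-weight ω@(_ ◅ _ ◅ _ ◅ _) simple = ⊥-elim (acyclic (simple-cycle ω simple (s≤s (s≤s (s≤s z≤n)))))


  revisits-weight : ∀ {x y} {ω : Star adj x y} (r : Revisits ω) → let open Revisits r in
                    weight ω ≡ weight loop + weight (prefix ◅◅ suffix)
  revisits-weight {ω = ω} r = begin
    weight ω                                      ≡⟨ cong weight decomposition ⟨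
    weight (prefix ◅◅ loop ◅◅ suffix)             ≡⟨ weight-◅◅ prefix (loop ◅◅ suffix) ⟩
    weight prefix + weight (loop ◅◅ suffix)       ≡⟨ cong (_+_ (weight prefix)) (weight-◅◅ loop suffix) ⟩
    weight prefix + (weight loop + weight suffix) ≡⟨ ℤ+.x∙yz≈y∙xz (weight prefix) (weight loop) (weight suffix) ⟩
    weight loop + (weight prefix + weight suffix) ≡⟨ cong (_+_ (weight loop)) (weight-◅◅ prefix suffix) ⟨
    weight loop + weight (prefix ◅◅ suffix)       ∎
    where
    open Revisits r
    open ≡-Reasoning

  closed-walk-weight : ∀ {x} (ω : Star adj x x) → weight ω ≡ 0ℤ
  closed-walk-weight ω = bounded (suc (length ω)) ω ℕ.≤-refl
    where
    bounded : ∀ L {x} (ω : Star adj x x) → length ω < L → weight ω ≡ 0ℤ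
    bounded (suc L) ω (s≤s len≤L) with simple-or-revisits ω
    ... | inj₁ simple = simple-closed-weight ω simple
    ... | inj₂ r = trans (revisits-weight r)
                         (cong₂ _+_ (bounded L loop (ℕ.<-≤-trans (proj₁ (revisits-shorter r)) len≤L))
                                    (bounded L (prefix ◅◅ suffix) (ℕ.<-≤-trans (proj₂ (revisits-shorter r)) len≤L)))
      where open Revisits r

  module Potential (root : Fin N) where

    potential : Fin N → ℤ
    potential x = weight (connected root x)

    potential-root : potential root ≡ 0ℤ
    potential-root = closed-walk-weight (connected root root)

    potential-edge : ∀ {x x′} (t : adj x x′) → potential x′ ≡ potential x + s t
    potential-edge {x} {x′} t = begin
      potential x′                                               ≡⟨ cancel (potential x) (s t) (potential x′) ⟩
      potential x + s t - (potential x + (s t + - potential x′)) ≡⟨ cong (λ a → potential x + s t - a) detour≡0 ⟩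
      potential x + s t - 0ℤ                                     ≡⟨ ℤ.+-identityʳ _ ⟩
      potential x + s t                                          ∎
      where
      open ≡-Reasoning
      cancel : ∀ p e a → a ≡ p + e - (p + (e + - a))
      cancel = solve-∀
      back : Star adj x′ root
      back = reverse flip-edge (connected root x′)
      detour : Star adj root root
      detour = connected root x ◅◅ t ◅ back
      detour≡0 : potential x + (s t + - potential x′) ≡ 0ℤ
      detour≡0 = begin
        potential x + (s t + - potential x′) ≡⟨ cong (λ a → potential x + (s t + a)) (weight-reverse (connected root x′)) ⟨
        potential x + (s t + weight back)    ≡⟨ weight-◅◅ (connected root x) (t ◅ back) ⟨
        weight detour                        ≡⟨ closed-walk-weight detour ⟩
        0ℤ                                   ∎

module Derived (n′ : ℕ) (V′ : Set) (σ : V′ ↔ Fin (suc n′))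
  (l : ℕ) (m : Fin l → ℕ) (N : (i : Fin l) → Fin (m i) → ℕ)
  (T : (i : Fin l) (j : Fin (m i)) → Adj (N i j)) (w : (i : Fin l) (j : Fin (m i)) → Fin (N i j)) where

  n : ℕ
  n = suc n′

  open Modular n

  G : Graph
  G = Sum l (λ i → Unicyclic (m i) (N i) (T i) (w i))

  a : (i : Fin l) → Fin (m i) → V G
  a i j = (i , (j , w i j))

  ι : V′ → Fin n
  ι = Inverse.to σ

  coordinate : V′ → ℤ
  coordinate y = + toℕ (ι y)

  point : ℤ → V′
  point L = Inverse.from σ ⟦ L ⟧

  coordinate-point : ∀ L → coordinate (point L) ≈ L
  coordinate-point L = subst (λ x → + toℕ x ≈ L) (sym (Inverse.strictlyInverseˡ σ ⟦ L ⟧)) (toℕ⟦⟧≈ L)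

  point-coordinate : ∀ {L y} → L ≈ coordinate y → point L ≡ y
  point-coordinate {L} {y} L≈y =
    trans (cong (Inverse.from σ) (trans (⟦⟧-cong L≈y) (⟦toℕ⟧ (ι y)))) (Inverse.strictlyInverseʳ σ y)

  Γarc⇒ : ∀ b {y y′} → Γarc σ b y y′ → coordinate y′ ≈ coordinate y + shift b
  Γarc⇒ false {y} {y′} y→y′ = ⟦⟧-injective (begin
    ⟦ coordinate y′ ⟧              ≡⟨ ⟦toℕ⟧ (ι y′) ⟩
    ι y′                           ≡⟨ y→y′ ⟩
    next (ι y)                     ≡⟨ cong next (⟦toℕ⟧ (ι y)) ⟨
    next ⟦ coordinate y ⟧          ≡⟨ next-⟦⟧ n′ (coordinate y) ⟩
    ⟦ coordinate y + shift false ⟧ ∎)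
    where open ≡-Reasoning
  Γarc⇒ true {y} {y′} y′→y = ≈-moveʳ (shift false) (Γarc⇒ false y′→y)

  Γarc⇐ : ∀ b {y y′} → coordinate y′ ≈ coordinate y + shift b → Γarc σ b y y′
  Γarc⇐ false {y} {y′} y′≈y+1 = begin
    ι y′                           ≡⟨ ⟦toℕ⟧ (ι y′) ⟨
    ⟦ coordinate y′ ⟧              ≡⟨ ⟦⟧-cong y′≈y+1 ⟩
    ⟦ coordinate y + shift false ⟧ ≡⟨ next-⟦⟧ n′ (coordinate y) ⟨
    next ⟦ coordinate y ⟧          ≡⟨ cong next (⟦toℕ⟧ (ι y)) ⟩
    next (ι y)                     ∎
    where open ≡-Reasoning
  Γarc⇐ true {y} {y′} y′≈y-1 = Γarc⇐ false (≈-moveʳ (shift true) y′≈y-1)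

  module Lift (A : V G → V G → Set) (orientation : IsOrientation G A) (h : V G → V G → Bool)
    (trees : ∀ i j → IsTree (T i j)) (dir : Fin l → Bool)
    (cycle-arcs : ∀ i j → if dir i then A (a i j) (a i (next j)) else A (a i (next j)) (a i j))
    (r : Fin l → ℕ)
    (count : ∀ i → countTrue (m i) (λ j → if dir i then h (a i j) (a i (next j)) else h (a i (next j)) (a i j)) ≡ r i)
    (k q : Fin l → ℕ) (order : ∀ i → IsSubgroupOrder n (+ m i - + (2 * r i)) (k i))
    (q*k≡n : ∀ i → q i * k i ≡ n) where

    open IsOrientation orientation

    P : Graph
    P = und (V G × V′) (ProdArc A h σ)

    arcVoltage : ∀ {u v} → A u v ⊎ A v u → ℤ
    arcVoltage {u} {v} (inj₁ _) = shift (h u v)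
    arcVoltage {u} {v} (inj₂ _) = - shift (h v u)

    voltage : ∀ {u v} → E G u v → ℤ
    voltage {u} {v} e = arcVoltage (Equivalence.to (edges u v) e)

    arcVoltage-forward : ∀ {u v} → A u v → (d : A u v ⊎ A v u) → arcVoltage d ≡ shift (h u v)
    arcVoltage-forward u→v (inj₁ _)   = refl
    arcVoltage-forward u→v (inj₂ v→u) = ⊥-elim (antisym _ _ u→v v→u)

    arcVoltage-backward : ∀ {u v} → A v u → (d : A u v ⊎ A v u) → arcVoltage d ≡ - shift (h v u)
    arcVoltage-backward v→u (inj₁ u→v) = ⊥-elim (antisym _ _ u→v v→u)
    arcVoltage-backward v→u (inj₂ _)   = refl

    voltage-forward : ∀ {u v} (e : E G u v) → A u v → voltage e ≡ shift (h u v)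
    voltage-forward {u} {v} e u→v = arcVoltage-forward u→v (Equivalence.to (edges u v) e)

    voltage-backward : ∀ {u v} (e : E G u v) → A v u → voltage e ≡ - shift (h v u)
    voltage-backward {u} {v} e v→u = arcVoltage-backward v→u (Equivalence.to (edges u v) e)

    voltage-flip : ∀ {u v} (e : E G u v) (e′ : E G v u) → voltage e′ ≡ - voltage e
    voltage-flip {u} {v} e e′ = along (Equivalence.to (edges u v) e)
      where
      along : (d : A u v ⊎ A v u) → voltage e′ ≡ - arcVoltage d
      along (inj₁ u→v) = voltage-backward e′ u→v
      along (inj₂ v→u) = trans (voltage-forward e′ v→u) (sym (ℤ.neg-involutive _))

    product-edge : ∀ {u v y y′} (e : E G u v) → coordinate y′ ≈ coordinate y + voltage e → E P (u , y) (v , y′)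
    product-edge {u} {v} e = along (Equivalence.to (edges u v) e)
      where
      along : ∀ {y y′} (d : A u v ⊎ A v u) → coordinate y′ ≈ coordinate y + arcVoltage d → E P (u , y) (v , y′)
      along (inj₁ u→v) y′≈y+s = inj₁ (u→v , Γarc⇐ (h u v) y′≈y+s)
      along (inj₂ v→u) y′≈y-s = inj₂ (v→u , Γarc⇐ (h v u) (≈-moveʳ⁻ (shift (h v u)) y′≈y-s))

    product-edge⁻¹ : ∀ {u v y y′} → E P (u , y) (v , y′) → Σ (E G u v) λ e → coordinate y′ ≈ coordinate y + voltage e
    product-edge⁻¹ {u} {v} {y} {y′} (inj₁ (u→v , y→y′)) =
      e , subst (λ s → coordinate y′ ≈ coordinate y + s) (sym (voltage-forward e u→v)) (Γarc⇒ (h u v) y→y′)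
      where e = Equivalence.from (edges u v) (inj₁ u→v)
    product-edge⁻¹ {u} {v} {y} {y′} (inj₂ (v→u , y′→y)) =
      e , subst (λ s → coordinate y′ ≈ coordinate y + s) (sym (voltage-backward e v→u))
                (≈-moveʳ (shift (h v u)) (Γarc⇒ (h v u) y′→y))
      where e = Equivalence.from (edges u v) (inj₂ v→u)

    point-edge : ∀ {u v L L′} (e : E G u v) → L′ ≈ L + voltage e → E P (u , point L) (v , point L′)
    point-edge {L = L} {L′} e L′≈L+s = product-edge e (begin
      coordinate (point L′)            ≈⟨ coordinate-point L′ ⟩
      L′                               ≈⟨ L′≈L+s ⟩
      L + voltage e                    ≈⟨ +-congʳ-≈ (voltage e) (coordinate-point L) ⟨
      coordinate (point L) + voltage e ∎)
      where open ≈-Reasoning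


    label : (i : Fin l) → Fin (m i) → Bool
    label i j = if dir i then h (a i j) (a i (next j)) else h (a i (next j)) (a i j)

    cycle-voltage : (i : Fin l) → Fin (m i) → ℤ
    cycle-voltage i j = orient (dir i) (shift (label i j))

    voltage-cycle : ∀ i j (e : E G (a i j) (a i (next j))) → voltage e ≡ cycle-voltage i j
    voltage-cycle i j e = along (dir i) (cycle-arcs i j)
      where
      along : ∀ b → (if b then A (a i j) (a i (next j)) else A (a i (next j)) (a i j)) →
              voltage e ≡ orient b (shift (if b then h (a i j) (a i (next j)) else h (a i (next j)) (a i j)))
      along true  arc = voltage-forward e arc
      along false arc = voltage-backward e arc

    net-voltage : Fin l → ℤ
    net-voltage i = sum (cycle-voltage i)

    net-voltage-order : ∀ i → IsSubgroupOrder n (net-voltage i) (k i)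
    net-voltage-order i =
      subst (λ g → IsSubgroupOrder n g (k i)) (sym net≡) (IsSubgroupOrder-orient (dir i) (order i))
      where
      net≡ : net-voltage i ≡ orient (dir i) (+ m i - + (2 * r i))
      net≡ = trans (sum-orient (dir i) (shift ∘ label i))
                   (cong (orient (dir i)) (trans (sum-shift (m i) (label i)) (cong (λ c → + m i - + (2 * c)) (count i))))

    k·net≈0 : ∀ i → + k i · net-voltage i ≈ 0ℤ
    k·net≈0 i = ∣ᵤ⇒≈0 (proj₁ (proj₂ (net-voltage-order i)))

    net-minimal : ∀ i d → 0 ℕ.< d → + d · net-voltage i ≈ 0ℤ → k i ℕ.≤ d
    net-minimal i d 0<d d·net≈0 = proj₂ (proj₂ (net-voltage-order i)) d 0<d (≈0⇒∣ᵤ d·net≈0)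

    instance
      k-nonZero : ∀ {i} → NonZero (k i)
      k-nonZero {i} = ℕ.>-nonZero (proj₁ (net-voltage-order i))

    module Coset (i : Fin l) =
      CosetDecomposition n (q i) (k i) (q*k≡n i) (net-voltage i) (k·net≈0 i) (net-minimal i)
    module Wind (i : Fin l) = Winding n (k i) (m i) (cycle-voltage i) (k·net≈0 i)

    quot : ∀ i → Fin (k i * m i) → Fin (k i)
    quot i = Wind.quot i

    rem : ∀ i → Fin (k i * m i) → Fin (m i)
    rem i = Wind.rem i

    height : ∀ i → Fin (k i * m i) → ℤ
    height i = Wind.height i

    tree-voltage : ∀ i j {x x′} → T i j x x′ → ℤ
    tree-voltage i j {x} {x′} t = voltage (inc i (j , x) (j , x′) (tree j x x′ t))

    module Tree (i : Fin l) (j : Fin (m i)) =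
      TreePotential (trees i j) (tree-voltage i j) (λ t t′ → voltage-flip _ _)

    potential : ∀ i j → Fin (N i j) → ℤ
    potential i j x = prefixSum (cycle-voltage i) j + Tree.Potential.potential i j (w i j) x

    potential-tree-edge : ∀ i j {x x′} (t : T i j x x′) → potential i j x′ ≡ potential i j x + tree-voltage i j t
    potential-tree-edge i j {x} t =
      trans (cong (_+_ (prefixSum (cycle-voltage i) j)) (Tree.Potential.potential-edge i j (w i j) t))
            (sym (ℤ.+-assoc (prefixSum (cycle-voltage i) j) _ (tree-voltage i j t)))

    potential-root : ∀ i j → potential i j (w i j) ≡ prefixSum (cycle-voltage i) j
    potential-root i j =
      trans (cong (_+_ (prefixSum (cycle-voltage i) j)) (Tree.Potential.potential-root i j (w i j))) (ℤ.+-identityʳ _)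

    Target : Graph
    Target = Sum l (λ i → copies (q i) (UnicyclicPow (m i) (N i) (T i) (w i) (k i)))

    offset : ∀ i → Fin (q i) → Fin (k i) → ℤ
    offset i c u = + toℕ c + + toℕ u · net-voltage i

    level : ∀ i (c : Fin (q i)) (p : Fin (k i * m i)) → Fin (N i (rem i p)) → ℤ
    level i c p x = offset i c (quot i p) + potential i (rem i p) x

    toProduct : V Target → V P
    toProduct (i , c , p , x) = (i , (rem i p , x)) , point (level i c p x)

    place : ∀ i → Fin (q i) × Fin (k i) → (j : Fin (m i)) → Fin (N i j) → V Target
    place i (c , u) j x = i , c , combine u j , subst (Fin ∘ N i) (sym (remainder-combine u j)) x

    fromProduct : V P → V Target
    fromProduct ((i , (j , x)) , y) = place i (Coset.β⁻¹ i ⟦ coordinate y - potential i j x ⟧) j x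

    toProduct-place : ∀ i c u j x → toProduct (place i (c , u) j x) ≡ ((i , (j , x)) , point (offset i c u + potential i j x))
    toProduct-place i c u j x = reindex (combine u j) (Fin.remQuot-combine u j)
      where
      image : V P
      image = (i , (j , x)) , point (offset i c u + potential i j x)
      reindex : ∀ p (e : remQuot (m i) p ≡ (u , j)) → toProduct (i , c , p , subst (Fin ∘ N i) (sym (cong proj₂ e)) x) ≡ image
      reindex p refl = refl

    toProduct-fromProduct : ∀ v → toProduct (fromProduct v) ≡ v
    toProduct-fromProduct ((i , (j , x)) , y) =
      trans (toProduct-place i c u j x) (cong ((i , (j , x)) ,_) (point-coordinate (begin
        offset i c u + π     ≈⟨ +-congʳ-≈ π (Coset.β⁻¹-offset i (coordinate y - π)) ⟩
        coordinate y - π + π ≡⟨ cancel (coordinate y) π ⟩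
        coordinate y         ∎)))
      where
      open ≈-Reasoning
      π = potential i j x
      c = proj₁ (Coset.β⁻¹ i ⟦ coordinate y - π ⟧)
      u = proj₂ (Coset.β⁻¹ i ⟦ coordinate y - π ⟧)
      cancel : ∀ a b → a - b + b ≡ a
      cancel = solve-∀

    β⁻¹-level : ∀ i c p x →
                Coset.β⁻¹ i ⟦ coordinate (point (level i c p x)) - potential i (rem i p) x ⟧ ≡ (c , quot i p)
    β⁻¹-level i c p x = trans (cong (Coset.β⁻¹ i) (⟦⟧-cong offset≈)) (Coset.β⁻¹-β i (c , quot i p))
      where
      j = rem i p
      L = level i c p x
      cancel : ∀ a b → a + b - b ≡ a
      cancel = solve-∀
      offset≈ : coordinate (point L) - potential i j x ≈ offset i c (quot i p)
      offset≈ = ≈-trans (+-congʳ-≈ (- potential i j x) (coordinate-point L))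
                        (≈-reflexive (cancel (offset i c (quot i p)) (potential i j x)))

    fromProduct-toProduct : ∀ t → fromProduct (toProduct t) ≡ t
    fromProduct-toProduct (i , c , p , x) =
      trans (cong (λ cu → place i cu (rem i p) x) (β⁻¹-level i c p x))
            (cong (λ px → (i , c , px)) (combine-remQuot-Σ {k i} {m i} {Fin ∘ N i} p x))

    cycle-vertex : ∀ i → Fin (q i) → Fin (k i * m i) → V Target
    cycle-vertex i c p = i , c , p , w i (rem i p)

    level-root : ∀ i c p → level i c p (w i (rem i p)) ≡ + toℕ c + height i p
    level-root i c p = trans (cong (_+_ (offset i c (quot i p))) (potential-root i (rem i p)))
                             (ℤ.+-assoc (+ toℕ c) (+ toℕ (quot i p) · net-voltage i) (prefixSum (cycle-voltage i) (rem i p)))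

    level-next : ∀ i c p → level i c (next p) (w i (rem i (next p))) ≈ level i c p (w i (rem i p)) + cycle-voltage i (rem i p)
    level-next i c p = begin
      level i c (next p) (w i (rem i (next p)))               ≡⟨ level-root i c (next p) ⟩
      + toℕ c + height i (next p)                             ≈⟨ +-congˡ-≈ (+ toℕ c) (Wind.height-next i p) ⟩
      + toℕ c + (height i p + cycle-voltage i (rem i p))      ≡⟨ ℤ.+-assoc (+ toℕ c) (height i p) _ ⟨
      + toℕ c + height i p + cycle-voltage i (rem i p)        ≡⟨ cong (_+ cycle-voltage i (rem i p)) (level-root i c p) ⟨
      level i c p (w i (rem i p)) + cycle-voltage i (rem i p) ∎
      where open ≈-Reasoning

    cycle-edge : ∀ i j j′ → j′ ≡ next j → ∀ {L L′} → L′ ≈ L + cycle-voltage i j →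
                 E P (a i j , point L) (a i j′ , point L′)
    cycle-edge i j .(next j) refl {L} {L′} L′≈L+s =
      point-edge e (subst (λ s → L′ ≈ L + s) (sym (voltage-cycle i j e)) L′≈L+s)
      where
      e : E G (a i j) (a i (next j))
      e = inc i _ _ (cyc j (next j) (inj₁ refl))

    P-sym : ∀ {v v′} → E P v v′ → E P v′ v
    P-sym = swap

    toProduct-edge : ∀ {t t′} → E Target t t′ → E P (toProduct t) (toProduct t′)
    toProduct-edge (inc i _ _ (inc c _ _ (tree p x x′ t))) =
      point-edge (inc i _ _ (tree j x x′ t)) (≈-reflexive (begin
        o + potential i j x′                       ≡⟨ cong (_+_ o) (potential-tree-edge i j t) ⟩
        o + (potential i j x + tree-voltage i j t) ≡⟨ ℤ.+-assoc o (potential i j x) (tree-voltage i j t) ⟨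
        level i c p x + tree-voltage i j t         ∎))
      where
      open ≡-Reasoning
      j = rem i p
      o = offset i c (quot i p)
    toProduct-edge (inc i _ _ (inc c _ _ (cyc p _ (inj₁ refl)))) =
      cycle-edge i (rem i p) (rem i (next p)) (Wind.remainder-next i p) (level-next i c p)
    toProduct-edge (inc i _ _ (inc c _ _ (cyc _ p′ (inj₂ refl)))) =
      P-sym (cycle-edge i (rem i p′) (rem i (next p′)) (Wind.remainder-next i p′) (level-next i c p′))

    Target-sym : ∀ {t t′} → E Target t t′ → E Target t′ t
    Target-sym (inc i _ _ (inc c _ _ (tree p x x′ t))) =
      inc i _ _ (inc c _ _ (tree p x′ x (IsTree.sym (trees i (rem i p)) x x′ t)))
    Target-sym (inc i _ _ (inc c _ _ (cyc p p′ adjacent))) = inc i _ _ (inc c _ _ (cyc p′ p (swap adjacent)))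

    place-tree-edge : ∀ i cu j {x x′} → T i j x x′ → E Target (place i cu j x) (place i cu j x′)
    place-tree-edge i (c , u) j t =
      inc i _ _ (inc c _ _ (tree (combine u j) _ _ (subst-rel (T i) (remainder-combine u j) t)))

    place-root : ∀ i c u j → place i (c , u) j (w i j) ≡ cycle-vertex i c (combine u j)
    place-root i c u j = cong (λ x → (i , c , combine u j , x)) (dcong (w i) (sym (remainder-combine u j)))

    fromProduct-tree-edge : ∀ i j {x x′ y y′} (t : T i j x x′) → coordinate y′ ≈ coordinate y + tree-voltage i j t →
                            E Target (fromProduct ((i , (j , x)) , y)) (fromProduct ((i , (j , x′)) , y′))
    fromProduct-tree-edge i j {x} {x′} {y} {y′} t y′≈y+s =
      subst (λ Y → E Target (place i (Coset.β⁻¹ i ⟦ Y₀ ⟧) j x) (place i (Coset.β⁻¹ i Y) j x′))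
            (⟦⟧-cong (≈-sym Y≈Y₀)) (place-tree-edge i (Coset.β⁻¹ i ⟦ Y₀ ⟧) j t)
      where
      π = potential i j x
      s = tree-voltage i j t
      Y₀ = coordinate y - π
      shuffle : ∀ a p s → a + s - (p + s) ≡ a - p
      shuffle = solve-∀
      Y≈Y₀ : coordinate y′ - potential i j x′ ≈ Y₀
      Y≈Y₀ = begin
        coordinate y′ - potential i j x′ ≡⟨ cong (_-_ (coordinate y′)) (potential-tree-edge i j t) ⟩
        coordinate y′ - (π + s)          ≈⟨ +-congʳ-≈ (- (π + s)) y′≈y+s ⟩
        coordinate y + s - (π + s)       ≡⟨ shuffle (coordinate y) π s ⟩
        Y₀                               ∎
        where open ≈-Reasoning

    fromProduct-cycle-edge : ∀ i j {y y′} → coordinate y′ ≈ coordinate y + cycle-voltage i j →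
                             E Target (fromProduct (a i j , y)) (fromProduct (a i (next j) , y′))
    fromProduct-cycle-edge i j {y} {y′} y′≈y+s =
      subst₂ (E Target) (sym start) finish (inc i _ _ (inc c _ _ (cyc p (next p) (inj₁ refl))))
      where
      c = proj₁ (Coset.β⁻¹ i ⟦ coordinate y - potential i j (w i j) ⟧)
      u = proj₂ (Coset.β⁻¹ i ⟦ coordinate y - potential i j (w i j) ⟧)
      p = combine u j
      start : fromProduct (a i j , y) ≡ cycle-vertex i c p
      start = place-root i c u j
      L₀ = level i c p (w i (rem i p))
      level≈y : L₀ ≈ coordinate y
      level≈y = subst (λ y″ → L₀ ≈ coordinate y″)
                      (cong proj₂ (trans (cong toProduct (sym start)) (toProduct-fromProduct (a i j , y))))
                      (≈-sym (coordinate-point _))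
      level≈y′ : level i c (next p) (w i (rem i (next p))) ≈ coordinate y′
      level≈y′ = begin
        level i c (next p) (w i (rem i (next p))) ≈⟨ level-next i c p ⟩
        L₀ + cycle-voltage i (rem i p)            ≡⟨ cong (λ j′ → L₀ + cycle-voltage i j′) (remainder-combine u j) ⟩
        L₀ + cycle-voltage i j                    ≈⟨ +-congʳ-≈ (cycle-voltage i j) level≈y ⟩
        coordinate y + cycle-voltage i j          ≈⟨ y′≈y+s ⟨
        coordinate y′                             ∎
        where open ≈-Reasoning
      image : toProduct (cycle-vertex i c (next p)) ≡ (a i (next j) , y′)
      image = cong₂ _,_ (cong (a i) (trans (Wind.remainder-next i p) (cong next (remainder-combine u j))))
                        (point-coordinate level≈y′)
      finish : cycle-vertex i c (next p) ≡ fromProduct (a i (next j) , y′)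
      finish = trans (sym (fromProduct-toProduct (cycle-vertex i c (next p)))) (cong fromProduct image)

    fromProduct-G-edge : ∀ {u u′ y y′} (e : E G u u′) → coordinate y′ ≈ coordinate y + voltage e →
                         E Target (fromProduct (u , y)) (fromProduct (u′ , y′))
    fromProduct-G-edge (inc i _ _ (tree j x x′ t)) y′≈y+s = fromProduct-tree-edge i j t y′≈y+s
    fromProduct-G-edge {y = y} {y′} e@(inc i _ _ (cyc j _ (inj₁ refl))) y′≈y+s =
      fromProduct-cycle-edge i j (subst (λ s → coordinate y′ ≈ coordinate y + s) (voltage-cycle i j e) y′≈y+s)
    fromProduct-G-edge {y = y} {y′} e@(inc i _ _ (cyc _ j (inj₂ refl))) y′≈y+s =
      Target-sym (fromProduct-cycle-edge i j
        (subst (λ s → coordinate y ≈ coordinate y′ + s) flipped (≈-moveʳ (voltage e) y′≈y+s)))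
      where
      flipped : - voltage e ≡ cycle-voltage i j
      flipped = trans (sym (voltage-flip e (inc i _ _ (cyc j (next j) (inj₁ refl))))) (voltage-cycle i j _)

    fromProduct-edge : ∀ {v v′} → E P v v′ → E Target (fromProduct v) (fromProduct v′)
    fromProduct-edge edge = fromProduct-G-edge (proj₁ (product-edge⁻¹ edge)) (proj₂ (product-edge⁻¹ edge))

    iso : P ≅ Target
    iso = record
      { bij = mk↔ₛ′ fromProduct toProduct fromProduct-toProduct toProduct-fromProduct
      ; adj = λ v v′ → mk⇔ fromProduct-edge
                           (λ edge → subst₂ (E P) (toProduct-fromProduct v) (toProduct-fromProduct v′) (toProduct-edge edge)) }

theorem3p2 :
    (n : ℕ) → 1 ≤ n → (V' : Set) (σ : V' ↔ Fin n) →
    (l : ℕ) (m : Fin l → ℕ) (N : (i : Fin l) → Fin (m i) → ℕ)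
    (T : (i : Fin l) (j : Fin (m i)) → Adj (N i j))
    (w : (i : Fin l) (j : Fin (m i)) → Fin (N i j)) →
    (∀ i → 3 ≤ m i) → (∀ i j → IsTree (T i j)) →
    let G : Graph
        G = Sum l (λ i → Unicyclic (m i) (N i) (T i) (w i))
        a : (i : Fin l) → Fin (m i) → V G
        a i j = (i , (j , w i j))
    in (A : V G → V G → Set) → IsOrientation G A →
    (dir : Fin l → Bool) →
    (∀ i j → if dir i then A (a i j) (a i (next j)) else A (a i (next j)) (a i j)) →
    (h : V G → V G → Bool) → (r : Fin l → ℕ) →
    (∀ i → countTrue (m i) (λ j → if dir i then h (a i j) (a i (next j)) else h (a i (next j)) (a i j)) ≡ r i) →
    (k q : Fin l → ℕ) →
    (∀ i → IsSubgroupOrder n (+ m i - + (2 * r i)) (k i)) →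
    (∀ i → q i * k i ≡ n) →
    und (V G × V') (ProdArc A h σ) ≅ Sum l (λ i → copies (q i) (UnicyclicPow (m i) (N i) (T i) (w i) (k i)))
theorem3p2 (suc n′) _ V′ σ l m N T w _ trees A orientation dir cycle-arcs h r count k q order q*k≡n =
  Derived.Lift.iso n′ V′ σ l m N T w A orientation h trees dir cycle-arcs r count k q order q*k≡n
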